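{- For all $f,g\in\mathcal O_K$, $$|f\pm g|_\theta\le \theta^2\max\{|f|_\theta,|g|_\theta\}.$$
   Context: $\theta>1$ is a real quadratic unit with $N(\theta)=-1$, so $\theta^2=a\theta+1$ with an integer $a\ge1$; $K=\mathbb Q(\theta)\subset\mathbb R$, $\mathcal O_K$ its ring of integers. A greedy polynomial is a finite sum $\sum_{i=m}^M b_i\theta^i$ with $b_i\in\{0,\dots,a\}$ such that $b_i=a$ implies $b_{i-1}=0$. Every nonzero $\alpha\in\mathcal O_K$ can be written uniquely as $\alpha=\pm\sum_{i=m}^M b_i\theta^i$ with the sum a greedy polynomial and $b_m\ne0$ (its greedy $\theta$-expansion). The $\theta$-adic infranorm is $|\alpha|_\theta:=\theta^{ -m}$ for such $\alpha$, and $|0|_\theta:=0$. -}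

module Defs where

open import Data.Nat as ℕ using (ℕ; zero; suc)
open import Data.Integer as ℤ using (ℤ; +_; -[1+_])
open import Data.List using (List; []; _∷_)
open import Data.Product using (Σ; _×_; _,_)
open import Data.Sum using (_⊎_)
open import Relation.Binary.PropositionalEquality using (_≡_)
open import Relation.Nullary using (¬_)

-- Elements x + y·θ of ℤ[θ], where θ² = a·θ + 1 (a is a parameter).
record Zθ : Set where
  constructor _+_θ
  field
    re : ℤ
    im : ℤ
open Zθ public

module _ (a : ℕ) where
  private A = + a

  zeroθ : Zθ
  zeroθ = (+ 0) + (+ 0) θ

  addθ : Zθ → Zθ → Zθ
  addθ (x + y θ) (u + v θ) = (x ℤ.+ u) + (y ℤ.+ v) θ

  negθ : Zθ → Zθ
  negθ (x + y θ) = (ℤ.- x) + (ℤ.- y) θ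

  subθ : Zθ → Zθ → Zθ
  subθ f g = addθ f (negθ g)

  mulθ : Zθ → Zθ
  mulθ (x + y θ) = y + (x ℤ.+ A ℤ.* y) θ

  -- multiplication by θ⁻¹ = θ - a :  θ⁻¹(x + yθ) = (y - a x) + xθ
  divθ : Zθ → Zθ
  divθ (x + y θ) = (y ℤ.- A ℤ.* x) + x θ

  mulθ^ : ℕ → Zθ → Zθ
  mulθ^ zero z = z
  mulθ^ (suc n) z = mulθ (mulθ^ n z)

  divθ^ : ℕ → Zθ → Zθ
  divθ^ zero z = z
  divθ^ (suc n) z = divθ (divθ^ n z)

  mulθℤ : ℤ → Zθ → Zθ
  mulθℤ (+ n) z = mulθ^ n z
  mulθℤ -[1+ n ] z = divθ^ (suc n) z

  natθ : ℕ → Zθ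
  natθ n = (+ n) + (+ 0) θ

  horner : List ℕ → Zθ
  horner [] = zeroθ
  horner (d ∷ ds) = addθ (natθ d) (mulθ (horner ds))

  -- Digit list b_m, b_{m+1}, …, b_M (increasing exponent) is greedy:
  -- every digit is in {0,…,a}, and b_i = a implies b_{i-1} = 0.
  data Greedy : List ℕ → Set where
    []  : Greedy []
    [_] : ∀ {x} → x ℕ.≤ a → Greedy (x ∷ [])
    cons : ∀ {x y ys} → x ℕ.≤ a → (y ≡ a → x ≡ 0) →
           Greedy (y ∷ ys) → Greedy (x ∷ y ∷ ys)

  data Sign : Set where
    plus minus : Sign

  applySign : Sign → Zθ → Zθ
  applySign plus z = z
  applySign minus z = negθ z

  record GreedyExpansion : Set where
    field
      sign   : Sign
      low    : ℤ
      lead   : ℕ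
      rest   : List ℕ
      lead≢0 : ¬ (lead ≡ 0)
      greedy : Greedy (lead ∷ rest)

    value : Zθ
    value = applySign sign (mulθℤ low (horner (lead ∷ rest)))

  data InfraVal : Set where
    0v   : InfraVal
    θ^_  : ℤ → InfraVal

  -- order on {0} ∪ θ^ℤ ⊂ ℝ (θ > 1, so θ^i ≤ θ^j ⟺ i ≤ j)
  data _≤v_ : InfraVal → InfraVal → Set where
    0≤ : ∀ {v} → 0v ≤v v
    θ≤ : ∀ {i j} → i ℤ.≤ j → (θ^ i) ≤v (θ^ j)

  maxv : InfraVal → InfraVal → InfraVal
  maxv 0v w = w
  maxv (θ^ i) 0v = θ^ i
  maxv (θ^ i) (θ^ j) = θ^ (i ℤ.⊔ j)

  θ²*_ : InfraVal → InfraVal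
  θ²* 0v = 0v
  θ²* (θ^ k) = θ^ (k ℤ.+ + 2)

  HasInfranorm : Zθ → InfraVal → Set
  HasInfranorm α v =
    (α ≡ zeroθ × v ≡ 0v) ⊎
    Σ GreedyExpansion (λ e → GreedyExpansion.value e ≡ α ×
                             v ≡ θ^ (ℤ.- GreedyExpansion.low e))

  pmθ : Sign → Zθ → Zθ → Zθ
  pmθ plus f g = addθ f g
  pmθ minus f g = subθ f g

{-# OPTIONS --safe #-}
module Submission where

-- Let h = f ± g have its greedy expansion starting at θᵐ. If the bound failed, f and g would
-- both be ±θ^(m+3)·P for greedy polynomials P (possibly 0), so after dividing by θᵐ a greedy
-- polynomial X with nonzero constant digit would equal ±θ³U ± θ³V with U, V greedy. Under the
-- Galois conjugation θ ↦ θ′ = −θ⁻¹, the greedy condition forces −1 < U′ < θ for every greedy U,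
-- and θ⁻¹ < X′ because the digit after a nonzero constant digit is below a. Since
-- θ³(θ³U)′ = −U′, unless both signs are negative this yields θ² < θ³X′ < 1 + θ ≤ aθ + 1 = θ².
-- If both are negative, X = −θ³(U + V) would be negative, but X > 0.

open import Defs
open import Data.Nat using (ℕ; _≤_)
open import Data.Nat as ℕ using (zero; suc; z≤n)
import Data.Nat.Properties as ℕP
open import Data.Integer as ℤ using (ℤ; +_; -[1+_])
import Data.Integer.Properties as ℤP
open import Data.Integer.Tactic.RingSolver using (solve-∀)
open import Data.List using (List; []; _∷_; _++_; replicate)
open import Data.Product using (Σ-syntax; _×_; _,_; proj₁; proj₂)
open import Data.Sum using (_⊎_; inj₁; inj₂)
open import Data.Empty using (⊥-elim)
open import Function using (_∘_; _$_)
open import Level using (0ℓ)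
open import Algebra.Bundles.Raw using (RawGroup)
open import Algebra.Morphism.Structures using (module GroupMorphisms)
import Algebra.Morphism.Construct.Identity as Identity
import Algebra.Morphism.Construct.Composition as Composition
open import Relation.Binary.Structures using (IsPreorder)
open import Relation.Binary.PropositionalEquality
open import Relation.Nullary using (¬_; yes; no)
import Relation.Binary.Reasoning.Base.Triple as Triple

exponent-gap : ∀ m k → ℤ.- m ℤ.≤ ℤ.- k ℤ.+ + 2 ⊎ Σ[ n ∈ ℕ ] k ≡ (m ℤ.+ + 3) ℤ.+ + n
exponent-gap m k with ℤ.- m ℤ.≤? ℤ.- k ℤ.+ + 2
... | yes −m≤−k+2 = inj₁ −m≤−k+2
... | no  −m≰−k+2 =
  inj₂ (ℤ.∣ δ ∣ , trans (k≡m+3+δ m k) (cong (λ n → (m ℤ.+ + 3) ℤ.+ n) (sym (ℤP.0≤i⇒+∣i∣≡i 0≤δ))))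
  where
  δ = ℤ.- m ℤ.- ℤ.suc (ℤ.- k ℤ.+ + 2)
  0≤δ : + 0 ℤ.≤ δ
  0≤δ = ℤP.i≤j⇒0≤j-i (ℤP.i<j⇒suc[i]≤j (ℤP.≰⇒> −m≰−k+2))
  k≡m+3+δ : ∀ m k → k ≡ (m ℤ.+ + 3) ℤ.+ (ℤ.- m ℤ.- (+ 1 ℤ.+ (ℤ.- k ℤ.+ + 2)))
  k≡m+3+δ = solve-∀

module _ (a : ℕ) where

  infixl 6 _⊕_ _⊖_
  infixr 8 ⊝_ θ*_ θ⁻¹*_ θ′*_

  _⊕_ _⊖_ : Zθ → Zθ → Zθ
  _⊕_ = addθ a
  _⊖_ = subθ a

  ⊝_ θ*_ θ⁻¹*_ θ′*_ : Zθ → Zθ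
  ⊝_    = negθ a
  θ*_   = mulθ a
  θ⁻¹*_ = divθ a
  θ′* z = ⊝ θ⁻¹* z

  𝟘 𝟙 ϑ ϑ² : Zθ
  𝟘  = zeroθ a
  𝟙  = natθ a 1
  ϑ  = θ* 𝟙
  ϑ² = θ* ϑ

  ⟨_⟩ : ℕ → Zθ
  ⟨_⟩ = natθ a

  -- x + yθ ↦ x + yθ′, using θ′ = −θ⁻¹ = a − θ
  conj : Zθ → Zθ
  conj (x + y θ) = (x ℤ.+ + a ℤ.* y) + (ℤ.- y) θ

  ⊕-comm : ∀ z w → z ⊕ w ≡ w ⊕ z
  ⊕-comm (x + y θ) (u + v θ) = cong₂ _+_θ (ℤP.+-comm x u) (ℤP.+-comm y v)

  ⊕-assoc : ∀ z w v → (z ⊕ w) ⊕ v ≡ z ⊕ (w ⊕ v)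
  ⊕-assoc (x + y θ) (u + v θ) (s + t θ) = cong₂ _+_θ (ℤP.+-assoc x u s) (ℤP.+-assoc y v t)

  ⊕-identityˡ : ∀ z → 𝟘 ⊕ z ≡ z
  ⊕-identityˡ (x + y θ) = cong₂ _+_θ (ℤP.+-identityˡ x) (ℤP.+-identityˡ y)

  ⊝-involutive : ∀ z → ⊝ ⊝ z ≡ z
  ⊝-involutive (x + y θ) = cong₂ _+_θ (ℤP.neg-involutive x) (ℤP.neg-involutive y)

  ⊝-distrib-⊕ : ∀ z w → ⊝ (z ⊕ w) ≡ ⊝ z ⊕ ⊝ w
  ⊝-distrib-⊕ (x + y θ) (u + v θ) = cong₂ _+_θ (ℤP.neg-distrib-+ x u) (ℤP.neg-distrib-+ y v)

  ⊖-self : ∀ z → z ⊖ z ≡ 𝟘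
  ⊖-self (x + y θ) = cong₂ _+_θ (ℤP.+-inverseʳ x) (ℤP.+-inverseʳ y)

  ⊖-telescope : ∀ z w v → (w ⊖ z) ⊕ (v ⊖ w) ≡ v ⊖ z
  ⊖-telescope (x + x′ θ) (y + y′ θ) (u + u′ θ) = cong₂ _+_θ (lemma x y u) (lemma x′ y′ u′)
    where
    lemma : ∀ x y u → (y ℤ.- x) ℤ.+ (u ℤ.- y) ≡ u ℤ.- x
    lemma = solve-∀

  ⊕-⊖-interchange : ∀ z z′ w w′ → (w ⊕ w′) ⊖ (z ⊕ z′) ≡ (w ⊖ z) ⊕ (w′ ⊖ z′)
  ⊕-⊖-interchange (x + x′ θ) (y + y′ θ) (u + u′ θ) (v + v′ θ) =
    cong₂ _+_θ (lemma x y u v) (lemma x′ y′ u′ v′)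
    where
    lemma : ∀ x y u v → (u ℤ.+ v) ℤ.- (x ℤ.+ y) ≡ (u ℤ.- x) ℤ.+ (v ℤ.- y)
    lemma = solve-∀

  ⊝-⊖-⊝ : ∀ z w → ⊝ z ⊖ ⊝ w ≡ w ⊖ z
  ⊝-⊖-⊝ (x + x′ θ) (y + y′ θ) = cong₂ _+_θ (lemma x y) (lemma x′ y′)
    where
    lemma : ∀ x y → ℤ.- x ℤ.- ℤ.- y ≡ y ℤ.- x
    lemma = solve-∀

  ⊖-⊖ : ∀ x y z → (z ⊖ y) ⊖ x ≡ z ⊖ (x ⊕ y)
  ⊖-⊖ (x + x′ θ) (y + y′ θ) (z + z′ θ) = cong₂ _+_θ (lemma x y z) (lemma x′ y′ z′)
    where
    lemma : ∀ x y z → (z ℤ.- y) ℤ.- x ≡ z ℤ.- (x ℤ.+ y)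
    lemma = solve-∀

  ⊖-identityʳ : ∀ z → z ⊖ 𝟘 ≡ z
  ⊖-identityʳ (x + y θ) = cong₂ _+_θ (ℤP.+-identityʳ x) (ℤP.+-identityʳ y)

  ⊝-inverseˡ : ∀ z → ⊝ z ⊕ z ≡ 𝟘
  ⊝-inverseˡ (x + y θ) = cong₂ _+_θ (ℤP.+-inverseˡ x) (ℤP.+-inverseˡ y)

  private
    linear-+ : ∀ A x y u v → (x ℤ.+ u) ℤ.+ A ℤ.* (y ℤ.+ v) ≡ (x ℤ.+ A ℤ.* y) ℤ.+ (u ℤ.+ A ℤ.* v)
    linear-+ = solve-∀

    linear-neg : ∀ A x y → ℤ.- x ℤ.+ A ℤ.* ℤ.- y ≡ ℤ.- (x ℤ.+ A ℤ.* y)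
    linear-neg = solve-∀

    linear-0 : ∀ A x → x ℤ.+ A ℤ.* + 0 ≡ x
    linear-0 = solve-∀

    colinear-+ : ∀ A x y u v → (y ℤ.+ v) ℤ.- A ℤ.* (x ℤ.+ u) ≡ (y ℤ.- A ℤ.* x) ℤ.+ (v ℤ.- A ℤ.* u)
    colinear-+ = solve-∀

    colinear-neg : ∀ A x y → ℤ.- y ℤ.- A ℤ.* ℤ.- x ≡ ℤ.- (y ℤ.- A ℤ.* x)
    colinear-neg = solve-∀

  θ*-⊕ : ∀ z w → θ* (z ⊕ w) ≡ θ* z ⊕ θ* w
  θ*-⊕ (x + y θ) (u + v θ) = cong₂ _+_θ refl (linear-+ (+ a) x y u v)

  θ*-⊝ : ∀ z → θ* ⊝ z ≡ ⊝ θ* z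
  θ*-⊝ (x + y θ) = cong₂ _+_θ refl (linear-neg (+ a) x y)

  θ*-𝟘 : θ* 𝟘 ≡ 𝟘
  θ*-𝟘 = cong₂ _+_θ refl (linear-0 (+ a) (+ 0))

  θ⁻¹*-⊕ : ∀ z w → θ⁻¹* (z ⊕ w) ≡ θ⁻¹* z ⊕ θ⁻¹* w
  θ⁻¹*-⊕ (x + y θ) (u + v θ) = cong₂ _+_θ (colinear-+ (+ a) x y u v) refl

  θ⁻¹*-⊝ : ∀ z → θ⁻¹* ⊝ z ≡ ⊝ θ⁻¹* z
  θ⁻¹*-⊝ (x + y θ) = cong₂ _+_θ (colinear-neg (+ a) x y) refl

  θ⁻¹*-𝟘 : θ⁻¹* 𝟘 ≡ 𝟘
  θ⁻¹*-𝟘 = cong₂ _+_θ (lemma (+ a)) refl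
    where
    lemma : ∀ A → + 0 ℤ.- A ℤ.* + 0 ≡ + 0
    lemma = solve-∀

  θ⁻¹*-θ* : ∀ z → θ⁻¹* θ* z ≡ z
  θ⁻¹*-θ* (x + y θ) = cong₂ _+_θ (lemma (+ a) x y) refl
    where
    lemma : ∀ A x y → (x ℤ.+ A ℤ.* y) ℤ.- A ℤ.* y ≡ x
    lemma = solve-∀

  θ*-θ⁻¹* : ∀ z → θ* θ⁻¹* z ≡ z
  θ*-θ⁻¹* (x + y θ) = cong₂ _+_θ refl (lemma (+ a) x y)
    where
    lemma : ∀ A x y → (y ℤ.- A ℤ.* x) ℤ.+ A ℤ.* x ≡ y
    lemma = solve-∀

  conj-⊕ : ∀ z w → conj (z ⊕ w) ≡ conj z ⊕ conj w
  conj-⊕ (x + y θ) (u + v θ) = cong₂ _+_θ (linear-+ (+ a) x y u v) (ℤP.neg-distrib-+ y v)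

  conj-⊝ : ∀ z → conj (⊝ z) ≡ ⊝ conj z
  conj-⊝ (x + y θ) = cong₂ _+_θ (linear-neg (+ a) x y) refl

  conj-𝟘 : conj 𝟘 ≡ 𝟘
  conj-𝟘 = cong₂ _+_θ (linear-0 (+ a) (+ 0)) refl

  conj-⟨⟩ : ∀ d → conj ⟨ d ⟩ ≡ ⟨ d ⟩
  conj-⟨⟩ d = cong₂ _+_θ (linear-0 (+ a) (+ d)) refl

  conj-θ* : ∀ z → conj (θ* z) ≡ θ′* conj z
  conj-θ* (x + y θ) = cong₂ _+_θ (lemma (+ a) x y) refl
    where
    lemma : ∀ A x y → y ℤ.+ A ℤ.* (x ℤ.+ A ℤ.* y) ≡ ℤ.- (ℤ.- y ℤ.- A ℤ.* (x ℤ.+ A ℤ.* y))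
    lemma = solve-∀

  ϑ-expansion : ϑ ≡ ⟨ a ⟩ ⊕ θ⁻¹* 𝟙
  ϑ-expansion = cong₂ _+_θ (lemma (+ a)) (linear-0 (+ a) (+ 1))
    where
    lemma : ∀ A → + 0 ≡ A ℤ.+ (+ 0 ℤ.- A ℤ.* + 1)
    lemma = solve-∀

  ϑ²-expansion : ϑ² ≡ 𝟙 ⊕ θ* ⟨ a ⟩
  ϑ²-expansion = cong₂ _+_θ (linear-0 (+ a) (+ 1)) (lemma (+ a))
    where
    lemma : ∀ A → + 0 ℤ.+ A ℤ.* (+ 1 ℤ.+ A ℤ.* + 0) ≡ + 0 ℤ.+ (A ℤ.+ A ℤ.* + 0)
    lemma = solve-∀

  θ*-cone : ∀ p q → θ* ((+ p) + (+ q) θ) ≡ (+ q) + (+ (p ℕ.+ a ℕ.* q)) θ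
  θ*-cone p q = cong (λ y → (+ q) + (+ p ℤ.+ y) θ) (sym (ℤP.pos-* a q))

  Zθ-rawGroup : RawGroup 0ℓ 0ℓ
  Zθ-rawGroup = record { Carrier = Zθ ; _≈_ = _≡_ ; _∙_ = _⊕_ ; ε = 𝟘 ; _⁻¹ = ⊝_ }

  open GroupMorphisms Zθ-rawGroup Zθ-rawGroup
    using ( IsGroupHomomorphism; IsGroupMonomorphism
          ; module IsGroupHomomorphism; module IsGroupMonomorphism)

  isGroupHomomorphism : {φ : Zθ → Zθ} →
    (∀ z w → φ (z ⊕ w) ≡ φ z ⊕ φ w) → φ 𝟘 ≡ 𝟘 → (∀ z → φ (⊝ z) ≡ ⊝ φ z) →
    IsGroupHomomorphism φ
  isGroupHomomorphism {φ} homo ε-homo ⁻¹-homo = record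
    { isMonoidHomomorphism = record
      { isMagmaHomomorphism = record
        { isRelHomomorphism = record { cong = cong φ }
        ; homo = homo
        }
      ; ε-homo = ε-homo
      }
    ; ⁻¹-homo = ⁻¹-homo
    }

  θ*-isGroupMonomorphism : IsGroupMonomorphism θ*_
  θ*-isGroupMonomorphism = record
    { isGroupHomomorphism = isGroupHomomorphism θ*-⊕ θ*-𝟘 θ*-⊝
    ; injective = λ {z} {w} eq → trans (sym (θ⁻¹*-θ* z)) (trans (cong θ⁻¹*_ eq) (θ⁻¹*-θ* w))
    }

  θ⁻¹*-isGroupMonomorphism : IsGroupMonomorphism θ⁻¹*_
  θ⁻¹*-isGroupMonomorphism = record
    { isGroupHomomorphism = isGroupHomomorphism θ⁻¹*-⊕ θ⁻¹*-𝟘 θ⁻¹*-⊝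
    ; injective = λ {z} {w} eq → trans (sym (θ*-θ⁻¹* z)) (trans (cong θ*_ eq) (θ*-θ⁻¹* w))
    }

  conj-isGroupHomomorphism : IsGroupHomomorphism conj
  conj-isGroupHomomorphism = isGroupHomomorphism conj-⊕ conj-𝟘 conj-⊝

  ⊝-isGroupHomomorphism : IsGroupHomomorphism ⊝_
  ⊝-isGroupHomomorphism = isGroupHomomorphism ⊝-distrib-⊕ refl (λ _ → refl)

  mulθ^-isGroupMonomorphism : ∀ n → IsGroupMonomorphism (mulθ^ a n)
  mulθ^-isGroupMonomorphism zero = Identity.isGroupMonomorphism Zθ-rawGroup refl
  mulθ^-isGroupMonomorphism (suc n) =
    Composition.isGroupMonomorphism trans (mulθ^-isGroupMonomorphism n) θ*-isGroupMonomorphism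

  divθ^-isGroupMonomorphism : ∀ n → IsGroupMonomorphism (divθ^ a n)
  divθ^-isGroupMonomorphism zero = Identity.isGroupMonomorphism Zθ-rawGroup refl
  divθ^-isGroupMonomorphism (suc n) =
    Composition.isGroupMonomorphism trans (divθ^-isGroupMonomorphism n) θ⁻¹*-isGroupMonomorphism

  mulθℤ-isGroupMonomorphism : ∀ k → IsGroupMonomorphism (mulθℤ a k)
  mulθℤ-isGroupMonomorphism (+ n)    = mulθ^-isGroupMonomorphism n
  mulθℤ-isGroupMonomorphism -[1+ n ] = divθ^-isGroupMonomorphism (suc n)

  applySign-isGroupHomomorphism : ∀ σ → IsGroupHomomorphism (applySign a σ)
  applySign-isGroupHomomorphism plus  = Identity.isGroupHomomorphism Zθ-rawGroup refl
  applySign-isGroupHomomorphism minus = ⊝-isGroupHomomorphism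

  module θ^  (n : ℕ)      = IsGroupMonomorphism (mulθ^-isGroupMonomorphism n)
  module θ^ℤ (k : ℤ)      = IsGroupMonomorphism (mulθℤ-isGroupMonomorphism k)
  module ±   (σ : Sign a) = IsGroupHomomorphism (applySign-isGroupHomomorphism σ)

  mulθ^-+ : ∀ m n z → mulθ^ a (m ℕ.+ n) z ≡ mulθ^ a m (mulθ^ a n z)
  mulθ^-+ zero    n z = refl
  mulθ^-+ (suc m) n z = cong θ*_ (mulθ^-+ m n z)

  mulθ^-suc : ∀ n z → mulθ^ a (suc n) z ≡ mulθ^ a n (θ* z)
  mulθ^-suc zero    z = refl
  mulθ^-suc (suc n) z = cong θ*_ (mulθ^-suc n z)

  divθ^-suc : ∀ n z → divθ^ a (suc n) z ≡ divθ^ a n (θ⁻¹* z)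
  divθ^-suc zero    z = refl
  divθ^-suc (suc n) z = cong θ⁻¹*_ (divθ^-suc n z)

  mulθℤ-+1 : ∀ k z → mulθℤ a (k ℤ.+ + 1) z ≡ mulθℤ a k (θ* z)
  mulθℤ-+1 (+ n) z rewrite ℕP.+-comm n 1 = mulθ^-suc n z
  mulθℤ-+1 -[1+ zero ]  z = sym (θ⁻¹*-θ* z)
  mulθℤ-+1 -[1+ suc n ] z =
    sym (trans (divθ^-suc (suc n) (θ* z)) (cong (divθ^ a (suc n)) (θ⁻¹*-θ* z)))

  mulθℤ-+ : ∀ k n z → mulθℤ a (k ℤ.+ + n) z ≡ mulθℤ a k (mulθ^ a n z)
  mulθℤ-+ k zero z = cong (λ j → mulθℤ a j z) (ℤP.+-identityʳ k)
  mulθℤ-+ k (suc n) z = begin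
    mulθℤ a (k ℤ.+ + suc n) z              ≡⟨ cong (λ j → mulθℤ a j z) (ℤP.+-assoc k (+ 1) (+ n)) ⟨
    mulθℤ a ((k ℤ.+ + 1) ℤ.+ + n) z        ≡⟨ mulθℤ-+ (k ℤ.+ + 1) n z ⟩
    mulθℤ a (k ℤ.+ + 1) (mulθ^ a n z)      ≡⟨ mulθℤ-+1 k (mulθ^ a n z) ⟩
    mulθℤ a k (mulθ^ a (suc n) z)          ∎
    where open ≡-Reasoning

  greedy-0∷ : ∀ {ds} → Greedy a ds → Greedy a (0 ∷ ds)
  greedy-0∷ {[]}    _ = [ z≤n ]
  greedy-0∷ {_ ∷ _} g = cons z≤n (λ _ → refl) g

  greedy-pad : ∀ n {ds} → Greedy a ds → Greedy a (replicate n 0 ++ ds)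
  greedy-pad zero    g = g
  greedy-pad (suc n) g = greedy-0∷ (greedy-pad n g)

  horner-pad : ∀ n ds → horner a (replicate n 0 ++ ds) ≡ mulθ^ a n (horner a ds)
  horner-pad zero    ds = refl
  horner-pad (suc n) ds =
    trans (⊕-identityˡ (θ* horner a (replicate n 0 ++ ds))) (cong θ*_ (horner-pad n ds))

  data Cone : Zθ → Set where
    cone : ∀ p q → Cone ((+ p) + (+ q) θ)

  data Cone⁺ : Zθ → Set where
    re⁺ : ∀ p q → Cone⁺ ((+ suc p) + (+ q) θ)
    im⁺ : ∀ p q → Cone⁺ ((+ p) + (+ suc q) θ)

  Cone⁺⇒Cone : ∀ {z} → Cone⁺ z → Cone z
  Cone⁺⇒Cone (re⁺ p q) = cone (suc p) q
  Cone⁺⇒Cone (im⁺ p q) = cone p (suc q)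

  ¬Cone⁺-𝟘 : ¬ Cone⁺ 𝟘
  ¬Cone⁺-𝟘 ()

  Cone-⊕ : ∀ {z w} → Cone z → Cone w → Cone (z ⊕ w)
  Cone-⊕ (cone p q) (cone p′ q′) = cone (p ℕ.+ p′) (q ℕ.+ q′)

  Cone⁺-⊕ : ∀ {z w} → Cone⁺ z → Cone w → Cone⁺ (z ⊕ w)
  Cone⁺-⊕ (re⁺ p q) (cone p′ q′) = re⁺ (p ℕ.+ p′) (q ℕ.+ q′)
  Cone⁺-⊕ (im⁺ p q) (cone p′ q′) = im⁺ (p ℕ.+ p′) (q ℕ.+ q′)

  Cone-⊕-Cone⁺ : ∀ {z w} → Cone z → Cone⁺ w → Cone⁺ (z ⊕ w)
  Cone-⊕-Cone⁺ {z} {w} c c⁺ = subst Cone⁺ (⊕-comm w z) (Cone⁺-⊕ c⁺ c)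

  Cone-θ* : ∀ {z} → Cone z → Cone (θ* z)
  Cone-θ* (cone p q) = subst Cone (sym (θ*-cone p q)) (cone q _)

  Cone⁺-θ* : ∀ {z} → Cone⁺ z → Cone⁺ (θ* z)
  Cone⁺-θ* (re⁺ p q) = subst Cone⁺ (sym (θ*-cone (suc p) q)) (im⁺ q _)
  Cone⁺-θ* (im⁺ p q) = subst Cone⁺ (sym (θ*-cone p (suc q))) (re⁺ q _)

  Cone-horner : ∀ ds → Cone (horner a ds)
  Cone-horner []       = cone 0 0
  Cone-horner (d ∷ ds) = Cone-⊕ (cone d 0) (Cone-θ* (Cone-horner ds))

  Cone⁺-horner : ∀ {d} ds → 1 ≤ d → Cone⁺ (horner a (d ∷ ds))
  Cone⁺-horner {suc d} ds _ = Cone⁺-⊕ (re⁺ d 0) (Cone-θ* (Cone-horner ds))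

  -- Since θ > 1, a multiple θᴺz lying in Cone (resp. Cone⁺) certifies z ≥ 0 (resp. z > 0) in ℝ.
  record Eventually (P : Zθ → Set) (z : Zθ) : Set where
    constructor _,_
    field
      exponent : ℕ
      holds    : P (mulθ^ a exponent z)

  NonNegative Positive : Zθ → Set
  NonNegative = Eventually Cone
  Positive    = Eventually Cone⁺

  module _ {P : Zθ → Set} (P-θ* : ∀ {z} → P z → P (θ* z)) where

    P-mulθ^ : ∀ n {z} → P z → P (mulθ^ a n z)
    P-mulθ^ zero    p = p
    P-mulθ^ (suc n) p = P-θ* (P-mulθ^ n p)

    Eventually-θ* : ∀ {z} → Eventually P z → Eventually P (θ* z)
    Eventually-θ* {z} (n , p) = n , subst P (mulθ^-suc n z) (P-θ* p)

  Eventually-θ⁻¹* : ∀ {P z} → Eventually P z → Eventually P (θ⁻¹* z)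
  Eventually-θ⁻¹* {P} {z} (n , p) =
    suc n , subst P (sym (trans (mulθ^-suc n (θ⁻¹* z)) (cong (mulθ^ a n) (θ*-θ⁻¹* z)))) p

  Eventually-⊕ : ∀ {P Q R : Zθ → Set} →
    (∀ {z} → P z → P (θ* z)) → (∀ {z} → Q z → Q (θ* z)) →
    (∀ {z w} → P z → Q w → R (z ⊕ w)) →
    ∀ {z w} → Eventually P z → Eventually Q w → Eventually R (z ⊕ w)
  Eventually-⊕ {P} {Q} {R} P-θ* Q-θ* P⊕Q {z} {w} (m , p) (n , q) =
    n ℕ.+ m , subst R (sym (θ^.∙-homo (n ℕ.+ m) z w)) (P⊕Q p′ q′)
    where
    p′ : P (mulθ^ a (n ℕ.+ m) z)
    p′ = subst P (sym (mulθ^-+ n m z)) (P-mulθ^ {P} P-θ* n p)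
    q′ : Q (mulθ^ a (n ℕ.+ m) w)
    q′ = subst Q (sym (trans (cong (λ k → mulθ^ a k w) (ℕP.+-comm n m)) (mulθ^-+ m n w)))
               (P-mulθ^ {Q} Q-θ* m q)

  ¬Positive-𝟘 : ¬ Positive 𝟘
  ¬Positive-𝟘 (n , p) =
    ¬Cone⁺-𝟘 (subst Cone⁺ (θ^.ε-homo n) p)

  infix 4 _≤ℝ_ _<ℝ_

  record _≤ℝ_ (z w : Zθ) : Set where
    constructor nonnegative
    field difference : NonNegative (w ⊖ z)

  record _<ℝ_ (z w : Zθ) : Set where
    constructor positive
    field difference : Positive (w ⊖ z)

  ≤ℝ-reflexive : ∀ {z w} → z ≡ w → z ≤ℝ w
  ≤ℝ-reflexive {z} refl = nonnegative (subst NonNegative (sym (⊖-self z)) (0 , cone 0 0))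

  ≤ℝ-trans : ∀ {z w v} → z ≤ℝ w → w ≤ℝ v → z ≤ℝ v
  ≤ℝ-trans {z} {w} {v} (nonnegative p) (nonnegative q) = nonnegative
    (subst NonNegative (⊖-telescope z w v) (Eventually-⊕ Cone-θ* Cone-θ* Cone-⊕ p q))

  <ℝ-≤ℝ-trans : ∀ {z w v} → z <ℝ w → w ≤ℝ v → z <ℝ v
  <ℝ-≤ℝ-trans {z} {w} {v} (positive p) (nonnegative q) = positive
    (subst Positive (⊖-telescope z w v) (Eventually-⊕ Cone⁺-θ* Cone-θ* Cone⁺-⊕ p q))

  ≤ℝ-<ℝ-trans : ∀ {z w v} → z ≤ℝ w → w <ℝ v → z <ℝ v
  ≤ℝ-<ℝ-trans {z} {w} {v} (nonnegative p) (positive q) = positive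
    (subst Positive (⊖-telescope z w v) (Eventually-⊕ Cone-θ* Cone⁺-θ* Cone-⊕-Cone⁺ p q))

  <ℝ⇒≤ℝ : ∀ {z w} → z <ℝ w → z ≤ℝ w
  <ℝ⇒≤ℝ (positive (n , p)) = nonnegative (n , Cone⁺⇒Cone p)

  <ℝ-trans : ∀ {z w v} → z <ℝ w → w <ℝ v → z <ℝ v
  <ℝ-trans p q = <ℝ-≤ℝ-trans p (<ℝ⇒≤ℝ q)

  <ℝ-irrefl : ∀ {z} → ¬ z <ℝ z
  <ℝ-irrefl {z} (positive p) = ¬Positive-𝟘 (subst Positive (⊖-self z) p)

  <ℝ-asym : ∀ {z w} → z <ℝ w → ¬ w <ℝ z
  <ℝ-asym p q = <ℝ-irrefl (<ℝ-trans p q)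

  ≤ℝ-isPreorder : IsPreorder _≡_ _≤ℝ_
  ≤ℝ-isPreorder = record
    { isEquivalence = isEquivalence
    ; reflexive     = ≤ℝ-reflexive
    ; trans         = ≤ℝ-trans
    }

  module ℝ-Reasoning = Triple {_≤_ = _≤ℝ_} {_<_ = _<ℝ_}
    ≤ℝ-isPreorder <ℝ-asym <ℝ-trans (resp₂ _<ℝ_) <ℝ⇒≤ℝ <ℝ-≤ℝ-trans ≤ℝ-<ℝ-trans

  ⊕-mono-≤ℝ : ∀ {z z′ w w′} → z ≤ℝ w → z′ ≤ℝ w′ → z ⊕ z′ ≤ℝ w ⊕ w′
  ⊕-mono-≤ℝ {z} {z′} {w} {w′} (nonnegative p) (nonnegative q) = nonnegative $
    subst NonNegative (sym (⊕-⊖-interchange z z′ w w′)) (Eventually-⊕ Cone-θ* Cone-θ* Cone-⊕ p q)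

  ⊕-mono-≤ℝ-<ℝ : ∀ {z z′ w w′} → z ≤ℝ w → z′ <ℝ w′ → z ⊕ z′ <ℝ w ⊕ w′
  ⊕-mono-≤ℝ-<ℝ {z} {z′} {w} {w′} (nonnegative p) (positive q) = positive $
    subst Positive (sym (⊕-⊖-interchange z z′ w w′)) (Eventually-⊕ Cone-θ* Cone⁺-θ* Cone-⊕-Cone⁺ p q)

  ⊕-mono-<ℝ : ∀ {z z′ w w′} → z <ℝ w → z′ <ℝ w′ → z ⊕ z′ <ℝ w ⊕ w′
  ⊕-mono-<ℝ p q = ⊕-mono-≤ℝ-<ℝ (<ℝ⇒≤ℝ p) q

  ⊕-monoʳ-≤ℝ : ∀ z {w w′} → w ≤ℝ w′ → z ⊕ w ≤ℝ z ⊕ w′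
  ⊕-monoʳ-≤ℝ z = ⊕-mono-≤ℝ (≤ℝ-reflexive {z} refl)

  ⊕-monoˡ-≤ℝ : ∀ z {w w′} → w ≤ℝ w′ → w ⊕ z ≤ℝ w′ ⊕ z
  ⊕-monoˡ-≤ℝ z p = ⊕-mono-≤ℝ p (≤ℝ-reflexive {z} refl)

  ⊕-monoʳ-<ℝ : ∀ z {w w′} → w <ℝ w′ → z ⊕ w <ℝ z ⊕ w′
  ⊕-monoʳ-<ℝ z = ⊕-mono-≤ℝ-<ℝ (≤ℝ-reflexive {z} refl)

  θ*-⊖ : ∀ z w → θ* (w ⊖ z) ≡ θ* w ⊖ θ* z
  θ*-⊖ z w = trans (θ*-⊕ w (⊝ z)) (cong (θ* w ⊕_) (θ*-⊝ z))

  θ⁻¹*-⊖ : ∀ z w → θ⁻¹* (w ⊖ z) ≡ θ⁻¹* w ⊖ θ⁻¹* z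
  θ⁻¹*-⊖ z w = trans (θ⁻¹*-⊕ w (⊝ z)) (cong (θ⁻¹* w ⊕_) (θ⁻¹*-⊝ z))

  θ*-mono-≤ℝ : ∀ {z w} → z ≤ℝ w → θ* z ≤ℝ θ* w
  θ*-mono-≤ℝ {z} {w} (nonnegative p) = nonnegative $ subst NonNegative (θ*-⊖ z w) (Eventually-θ* Cone-θ* p)

  θ*-mono-<ℝ : ∀ {z w} → z <ℝ w → θ* z <ℝ θ* w
  θ*-mono-<ℝ {z} {w} (positive p) = positive $ subst Positive (θ*-⊖ z w) (Eventually-θ* Cone⁺-θ* p)

  θ′*-anti-<ℝ : ∀ {z w} → z <ℝ w → θ′* w <ℝ θ′* z
  θ′*-anti-<ℝ {z} {w} (positive p) = positive $
    subst Positive (trans (θ⁻¹*-⊖ z w) (sym (⊝-⊖-⊝ (θ⁻¹* z) (θ⁻¹* w)))) (Eventually-θ⁻¹* p)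

  ⊝-anti-<ℝ : ∀ {z w} → z <ℝ w → ⊝ w <ℝ ⊝ z
  ⊝-anti-<ℝ {z} {w} (positive p) = positive (subst Positive (sym (⊝-⊖-⊝ z w)) p)

  ⟨⟩-mono-≤ℝ : ∀ {m n} → m ≤ n → ⟨ m ⟩ ≤ℝ ⟨ n ⟩
  ⟨⟩-mono-≤ℝ {m} m≤n with ℕP.m≤n⇒∃[o]m+o≡n m≤n
  ... | o , refl = nonnegative (subst NonNegative (sym ⟨m+o⟩⊖⟨m⟩) (0 , cone o 0))
    where
    lemma : ∀ x y → (x ℤ.+ y) ℤ.- x ≡ y
    lemma = solve-∀
    ⟨m+o⟩⊖⟨m⟩ : ⟨ m ℕ.+ o ⟩ ⊖ ⟨ m ⟩ ≡ ⟨ o ⟩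
    ⟨m+o⟩⊖⟨m⟩ = cong₂ _+_θ (trans (cong (ℤ._- + m) (ℤP.pos-+ m o)) (lemma (+ m) (+ o))) refl

  <ℝ-⊖ : ∀ {x} y {z} → x ⊕ y <ℝ z → x <ℝ z ⊖ y
  <ℝ-⊖ {x} y {z} (positive p) = positive (subst Positive (sym (⊖-⊖ x y z)) p)

  𝟘<ℝθ⁻¹*𝟙 : 𝟘 <ℝ θ⁻¹* 𝟙
  𝟘<ℝθ⁻¹*𝟙 = positive $ subst Positive (sym (⊖-identityʳ (θ⁻¹* 𝟙))) (Eventually-θ⁻¹* (0 , re⁺ 0 0))

  𝟙<ℝϑ : 1 ≤ a → 𝟙 <ℝ ϑ
  𝟙<ℝϑ 1≤a = begin-strict
    𝟙 ⊕ 𝟘               <⟨ ⊕-mono-≤ℝ-<ℝ (⟨⟩-mono-≤ℝ 1≤a) 𝟘<ℝθ⁻¹*𝟙 ⟩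
    ⟨ a ⟩ ⊕ θ⁻¹* 𝟙      ≡⟨ ϑ-expansion ⟨
    ϑ                   ∎
    where open ℝ-Reasoning

  𝟙⊕ϑ≤ℝϑ² : 1 ≤ a → 𝟙 ⊕ ϑ ≤ℝ ϑ²
  𝟙⊕ϑ≤ℝϑ² 1≤a = begin
    𝟙 ⊕ ϑ               ≤⟨ ⊕-monoʳ-≤ℝ 𝟙 (θ*-mono-≤ℝ (⟨⟩-mono-≤ℝ 1≤a)) ⟩
    𝟙 ⊕ θ* ⟨ a ⟩        ≡⟨ ϑ²-expansion ⟨
    ϑ²                  ∎
    where open ℝ-Reasoning

  θ*-θ′* : ∀ z → θ* θ′* z ≡ ⊝ z
  θ*-θ′* z = trans (θ*-⊝ (θ⁻¹* z)) (cong ⊝_ (θ*-θ⁻¹* z))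

  θ′*-ϑ : θ′* ϑ ≡ ⊝ 𝟙
  θ′*-ϑ = cong ⊝_ (θ⁻¹*-θ* 𝟙)

  θ′*-⊝𝟙 : θ′* ⊝ 𝟙 ≡ θ⁻¹* 𝟙
  θ′*-⊝𝟙 = trans (cong ⊝_ (θ⁻¹*-⊝ 𝟙)) (⊝-involutive (θ⁻¹* 𝟙))

  conj-horner-∷ : ∀ d ds → conj (horner a (d ∷ ds)) ≡ ⟨ d ⟩ ⊕ θ′* conj (horner a ds)
  conj-horner-∷ d ds =
    trans (conj-⊕ ⟨ d ⟩ (θ* horner a ds)) (cong₂ _⊕_ (conj-⟨⟩ d) (conj-θ* (horner a ds)))

  digit₀ : List ℕ → ℕ
  digit₀ []      = 0
  digit₀ (d ∷ _) = d

  greedy-digit₀≤ : ∀ {ds} → Greedy a ds → digit₀ ds ≤ a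
  greedy-digit₀≤ []             = z≤n
  greedy-digit₀≤ [ d≤a ]        = d≤a
  greedy-digit₀≤ (cons d≤a _ _) = d≤a

  greedy-tail : ∀ {d ds} → Greedy a (d ∷ ds) → Greedy a ds
  greedy-tail [ _ ]        = []
  greedy-tail (cons _ _ g) = g

  greedy-digit₁< : ∀ {d ds} → Greedy a (d ∷ ds) → 1 ≤ d → digit₀ ds ℕ.< a
  greedy-digit₁< [ d≤a ]          1≤d = ℕP.≤-trans 1≤d d≤a
  greedy-digit₁< (cons _ a→0 g) 1≤d =
    ℕP.≤∧≢⇒< (greedy-digit₀≤ g) (λ e≡a → ℕP.m<n⇒n≢0 1≤d (a→0 e≡a))

  record ConjBounds (d : ℕ) (t : Zθ) : Set where
    field
      lower : ⊝ 𝟙 <ℝ t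
      upper : t <ℝ ⟨ d ⟩ ⊕ θ⁻¹* 𝟙

  ConjBounds-<ℝϑ : ∀ {d t} → d ≤ a → ConjBounds d t → t <ℝ ϑ
  ConjBounds-<ℝϑ {d} {t} d≤a b = begin-strict
    t                   <⟨ ConjBounds.upper b ⟩
    ⟨ d ⟩ ⊕ θ⁻¹* 𝟙      ≤⟨ ⊕-monoˡ-≤ℝ (θ⁻¹* 𝟙) (⟨⟩-mono-≤ℝ d≤a) ⟩
    ⟨ a ⟩ ⊕ θ⁻¹* 𝟙      ≡⟨ ϑ-expansion ⟨
    ϑ                   ∎
    where open ℝ-Reasoning

  ConjBounds-∷ : ∀ {d e s} → e ≤ a → ConjBounds e s → ConjBounds d (⟨ d ⟩ ⊕ θ′* s)
  ConjBounds-∷ {d} {e} {s} e≤a b = record { lower = lower ; upper = upper }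
    where
    open ℝ-Reasoning
    lower : ⊝ 𝟙 <ℝ ⟨ d ⟩ ⊕ θ′* s
    lower = begin-strict
      ⊝ 𝟙               ≡⟨ ⊕-identityˡ (⊝ 𝟙) ⟨
      𝟘 ⊕ ⊝ 𝟙           ≡⟨ cong (𝟘 ⊕_) θ′*-ϑ ⟨
      𝟘 ⊕ θ′* ϑ         <⟨ ⊕-mono-≤ℝ-<ℝ (⟨⟩-mono-≤ℝ z≤n) (θ′*-anti-<ℝ (ConjBounds-<ℝϑ e≤a b)) ⟩
      ⟨ d ⟩ ⊕ θ′* s     ∎
    upper : ⟨ d ⟩ ⊕ θ′* s <ℝ ⟨ d ⟩ ⊕ θ⁻¹* 𝟙
    upper = begin-strict
      ⟨ d ⟩ ⊕ θ′* s     <⟨ ⊕-monoʳ-<ℝ ⟨ d ⟩ (θ′*-anti-<ℝ (ConjBounds.lower b)) ⟩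
      ⟨ d ⟩ ⊕ θ′* ⊝ 𝟙   ≡⟨ cong (⟨ d ⟩ ⊕_) θ′*-⊝𝟙 ⟩
      ⟨ d ⟩ ⊕ θ⁻¹* 𝟙    ∎

  greedy-ConjBounds : ∀ {ds} → Greedy a ds → ConjBounds (digit₀ ds) (conj (horner a ds))
  greedy-ConjBounds [] = subst (ConjBounds 0) (sym conj-𝟘) record
    { lower = positive (0 , re⁺ 0 0)
    ; upper = subst (𝟘 <ℝ_) (sym (⊕-identityˡ (θ⁻¹* 𝟙))) 𝟘<ℝθ⁻¹*𝟙
    }
  greedy-ConjBounds {d ∷ []} [ _ ] =
    subst (ConjBounds d) (sym (conj-horner-∷ d [])) (ConjBounds-∷ z≤n (greedy-ConjBounds []))
  greedy-ConjBounds {d ∷ ds} (cons _ _ g) =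
    subst (ConjBounds d) (sym (conj-horner-∷ d ds)) (ConjBounds-∷ (greedy-digit₀≤ g) (greedy-ConjBounds g))

  greedy-conj-bounds : ∀ {ds} → Greedy a ds → ⊝ 𝟙 <ℝ conj (horner a ds) × conj (horner a ds) <ℝ ϑ
  greedy-conj-bounds g = ConjBounds.lower b , ConjBounds-<ℝϑ (greedy-digit₀≤ g) b
    where b = greedy-ConjBounds g

  greedy-𝟙<ℝθ*conj : ∀ {d ds} → Greedy a (d ∷ ds) → 1 ≤ d → 𝟙 <ℝ θ* conj (horner a (d ∷ ds))
  greedy-𝟙<ℝθ*conj {d} {ds} g 1≤d = subst (𝟙 <ℝ_) (sym θ*conj≡) (<ℝ-⊖ s (begin-strict
    𝟙 ⊕ s                     <⟨ ⊕-monoʳ-<ℝ 𝟙 (ConjBounds.upper (greedy-ConjBounds (greedy-tail g))) ⟩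
    𝟙 ⊕ (⟨ e ⟩ ⊕ θ⁻¹* 𝟙)      ≡⟨ ⊕-assoc 𝟙 ⟨ e ⟩ (θ⁻¹* 𝟙) ⟨
    ⟨ suc e ⟩ ⊕ θ⁻¹* 𝟙        ≤⟨ ⊕-monoˡ-≤ℝ (θ⁻¹* 𝟙) (⟨⟩-mono-≤ℝ (greedy-digit₁< g 1≤d)) ⟩
    ⟨ a ⟩ ⊕ θ⁻¹* 𝟙            ≡⟨ ϑ-expansion ⟨
    ϑ                         ≤⟨ θ*-mono-≤ℝ (⟨⟩-mono-≤ℝ 1≤d) ⟩
    θ* ⟨ d ⟩                  ∎))
    where
    open ℝ-Reasoning
    s = conj (horner a ds)
    e = digit₀ ds
    θ*conj≡ : θ* conj (horner a (d ∷ ds)) ≡ θ* ⟨ d ⟩ ⊖ s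
    θ*conj≡ = begin-equality
      θ* conj (horner a (d ∷ ds))   ≡⟨ cong θ*_ (conj-horner-∷ d ds) ⟩
      θ* (⟨ d ⟩ ⊕ θ′* s)            ≡⟨ θ*-⊕ ⟨ d ⟩ (θ′* s) ⟩
      θ* ⟨ d ⟩ ⊕ θ* θ′* s           ≡⟨ cong (θ* ⟨ d ⟩ ⊕_) (θ*-θ′* s) ⟩
      θ* ⟨ d ⟩ ⊖ s                  ∎

  θ³*_ : Zθ → Zθ
  θ³*_ = mulθ^ a 3

  applySign-comm : ∀ {φ} → IsGroupHomomorphism φ → ∀ σ z → φ (applySign a σ z) ≡ applySign a σ (φ z)
  applySign-comm φ-hom plus  z = refl
  applySign-comm φ-hom minus z = IsGroupHomomorphism.⁻¹-homo φ-hom z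

  θ³*-conj-θ³* : ∀ z → θ³* conj (θ³* z) ≡ ⊝ conj z
  θ³*-conj-θ³* z = begin
    θ* θ* θ* conj (θ* θ* θ* z)     ≡⟨ cong θ³*_ conj-θ³* ⟩
    θ* θ* θ* θ′* θ′* θ′* w         ≡⟨ cong (θ*_ ∘ θ*_) (θ*-θ′* (θ′* θ′* w)) ⟩
    θ* θ* ⊝ θ′* θ′* w              ≡⟨ cong θ*_ (θ*-⊝ (θ′* θ′* w)) ⟩
    θ* ⊝ θ* θ′* θ′* w              ≡⟨ cong (θ*_ ∘ ⊝_) (θ*-θ′* (θ′* w)) ⟩
    θ* ⊝ ⊝ θ′* w                   ≡⟨ cong θ*_ (⊝-involutive (θ′* w)) ⟩
    θ* θ′* w                       ≡⟨ θ*-θ′* w ⟩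
    ⊝ w                            ∎
    where
    open ≡-Reasoning
    w = conj z
    conj-θ³* : conj (θ³* z) ≡ θ′* θ′* θ′* w
    conj-θ³* = trans (conj-θ* (θ* θ* z)) (cong θ′*_ (trans (conj-θ* (θ* z)) (cong θ′*_ (conj-θ* z))))

  θ³*-conj-signed : ∀ σ z → θ³* conj (applySign a σ (θ³* z)) ≡ applySign a σ (⊝ conj z)
  θ³*-conj-signed σ z = begin
    θ³* conj (applySign a σ (θ³* z))   ≡⟨ cong θ³*_ (applySign-comm conj-isGroupHomomorphism σ (θ³* z)) ⟩
    θ³* applySign a σ (conj (θ³* z))   ≡⟨ applySign-comm (θ^.isGroupHomomorphism 3) σ (conj (θ³* z)) ⟩
    applySign a σ (θ³* conj (θ³* z))   ≡⟨ cong (applySign a σ) (θ³*-conj-θ³* z) ⟩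
    applySign a σ (⊝ conj z)           ∎
    where open ≡-Reasoning

  signed-conj-bound : 1 ≤ a → ∀ {us} → Greedy a us → ∀ σ → applySign a σ (⊝ conj (horner a us)) <ℝ ϑ
  signed-conj-bound 1≤a g plus  = <ℝ-trans (⊝-anti-<ℝ (proj₁ (greedy-conj-bounds g))) (𝟙<ℝϑ 1≤a)
  signed-conj-bound 1≤a g minus =
    subst (_<ℝ ϑ) (sym (⊝-involutive _)) (proj₂ (greedy-conj-bounds g))

  Cone⁺-≢-⊝-Cone : ∀ {x y} → Cone⁺ x → Cone y → x ≢ ⊝ y
  Cone⁺-≢-⊝-Cone {x} {y} x⁺ y⁰ x≡⊝y =
    ¬Cone⁺-𝟘 (subst Cone⁺ (trans (cong (_⊕ y) x≡⊝y) (⊝-inverseˡ y)) (Cone⁺-⊕ x⁺ y⁰))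

  Cone-θ³*-horner : ∀ ds → Cone (θ³* horner a ds)
  Cone-θ³*-horner ds = P-mulθ^ {Cone} Cone-θ* 3 {horner a ds} (Cone-horner ds)

  greedy-≢-θ³*-⊕-signed : 1 ≤ a → ∀ {d ds us vs} → Greedy a (d ∷ ds) → 1 ≤ d →
    Greedy a us → Greedy a vs → ∀ τ → horner a (d ∷ ds) ≢ θ³* horner a us ⊕ applySign a τ (θ³* horner a vs)
  greedy-≢-θ³*-⊕-signed 1≤a {d} {ds} {us} {vs} g 1≤d gu gv τ eq = <ℝ-irrefl (begin-strict
    ϑ²                                    <⟨ θ*-mono-<ℝ (θ*-mono-<ℝ (greedy-𝟙<ℝθ*conj g 1≤d)) ⟩
    θ³* conj (horner a (d ∷ ds))          ≡⟨ cong (θ³*_ ∘ conj) eq ⟩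
    θ³* conj (A ⊕ B)                      ≡⟨ cong θ³*_ (conj-⊕ A B) ⟩
    θ³* (conj A ⊕ conj B)                 ≡⟨ θ^.∙-homo 3 (conj A) (conj B) ⟩
    θ³* conj A ⊕ θ³* conj B               ≡⟨ cong₂ _⊕_ (θ³*-conj-θ³* u) (θ³*-conj-signed τ v) ⟩
    ⊝ conj u ⊕ applySign a τ (⊝ conj v)   <⟨ ⊕-mono-<ℝ ⊝conj-u<𝟙 (signed-conj-bound 1≤a gv τ) ⟩
    𝟙 ⊕ ϑ                                 ≤⟨ 𝟙⊕ϑ≤ℝϑ² 1≤a ⟩
    ϑ²                                    ∎)
    where
    open ℝ-Reasoning
    u = horner a us
    v = horner a vs
    A = θ³* u
    B = applySign a τ (θ³* v)
    ⊝conj-u<𝟙 : ⊝ conj u <ℝ 𝟙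
    ⊝conj-u<𝟙 = ⊝-anti-<ℝ (proj₁ (greedy-conj-bounds gu))

  greedy-≢-signed-sum : 1 ≤ a → ∀ {d ds us vs} → Greedy a (d ∷ ds) → 1 ≤ d → Greedy a us → Greedy a vs →
    ∀ σ τ → horner a (d ∷ ds) ≢ applySign a σ (θ³* horner a us) ⊕ applySign a τ (θ³* horner a vs)
  greedy-≢-signed-sum 1≤a g 1≤d gu gv plus τ = greedy-≢-θ³*-⊕-signed 1≤a g 1≤d gu gv τ
  greedy-≢-signed-sum 1≤a {us = us} {vs} g 1≤d gu gv minus plus eq =
    greedy-≢-θ³*-⊕-signed 1≤a g 1≤d gv gu minus (trans eq (⊕-comm (⊝ θ³* horner a us) (θ³* horner a vs)))
  greedy-≢-signed-sum 1≤a {ds = ds} {us} {vs} g 1≤d _ _ minus minus eq =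
    Cone⁺-≢-⊝-Cone (Cone⁺-horner ds 1≤d) (Cone-⊕ (Cone-θ³*-horner us) (Cone-θ³*-horner vs))
      (trans eq (sym (⊝-distrib-⊕ (θ³* horner a us) (θ³* horner a vs))))

  infixl 7 _·ₛ_
  _·ₛ_ : Sign a → Sign a → Sign a
  plus  ·ₛ τ     = τ
  minus ·ₛ plus  = minus
  minus ·ₛ minus = plus

  applySign-·ₛ : ∀ σ τ z → applySign a σ (applySign a τ z) ≡ applySign a (σ ·ₛ τ) z
  applySign-·ₛ plus  τ     z = refl
  applySign-·ₛ minus plus  z = refl
  applySign-·ₛ minus minus z = ⊝-involutive z

  applySign-involutive : ∀ σ z → applySign a σ (applySign a σ z) ≡ z
  applySign-involutive plus  z = refl
  applySign-involutive minus z = ⊝-involutive z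

  θ^ℤ-cancel : ∀ k σ τ τ′ {X U V} →
    applySign a σ (mulθℤ a k X) ≡ applySign a τ (mulθℤ a k U) ⊕ applySign a τ′ (mulθℤ a k V) →
    X ≡ applySign a (σ ·ₛ τ) U ⊕ applySign a (σ ·ₛ τ′) V
  θ^ℤ-cancel k σ τ τ′ {X} {U} {V} eq = θ^ℤ.injective k (begin
    φ X                           ≡⟨ applySign-involutive σ (φ X) ⟨
    σ̂ (σ̂ (φ X))                   ≡⟨ cong σ̂ eq ⟩
    σ̂ (τ̂ (φ U) ⊕ τ̂′ (φ V))        ≡⟨ ±.homo σ (τ̂ (φ U)) (τ̂′ (φ V)) ⟩
    σ̂ (τ̂ (φ U)) ⊕ σ̂ (τ̂′ (φ V))    ≡⟨ cong₂ _⊕_ (applySign-·ₛ σ τ (φ U)) (applySign-·ₛ σ τ′ (φ V)) ⟩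
    ρ (φ U) ⊕ ρ′ (φ V)            ≡⟨ cong₂ _⊕_ (applySign-comm φ-hom (σ ·ₛ τ) U)
                                               (applySign-comm φ-hom (σ ·ₛ τ′) V) ⟨
    φ (ρ U) ⊕ φ (ρ′ V)            ≡⟨ θ^ℤ.∙-homo k (ρ U) (ρ′ V) ⟨
    φ (ρ U ⊕ ρ′ V)                ∎)
    where
    open ≡-Reasoning
    φ = mulθℤ a k
    φ-hom = θ^ℤ.isGroupHomomorphism k
    σ̂ = applySign a σ
    τ̂ = applySign a τ
    τ̂′ = applySign a τ′
    ρ = applySign a (σ ·ₛ τ)
    ρ′ = applySign a (σ ·ₛ τ′)

  record GreedyFrom (k : ℤ) (f : Zθ) : Set where
    constructor greedyFrom
    field
      sign   : Sign a
      digits : List ℕ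
      greedy : Greedy a digits
      value≡ : f ≡ applySign a sign (mulθℤ a k (horner a digits))

  GreedyFrom-𝟘 : ∀ k → GreedyFrom k 𝟘
  GreedyFrom-𝟘 k = greedyFrom plus [] [] (sym (θ^ℤ.ε-homo k))

  GreedyFrom-applySign : ∀ σ {k f} → GreedyFrom k f → GreedyFrom k (applySign a σ f)
  GreedyFrom-applySign σ (greedyFrom τ ds g refl) = greedyFrom (σ ·ₛ τ) ds g (applySign-·ₛ σ τ _)

  expansion-GreedyFrom : ∀ (e : GreedyExpansion a) k n → GreedyExpansion.low e ≡ k ℤ.+ + n →
    GreedyFrom k (GreedyExpansion.value e)
  expansion-GreedyFrom e k n low≡ =
    greedyFrom sign (replicate n 0 ++ digits) (greedy-pad n greedy) (cong (applySign a sign) (begin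
      mulθℤ a low (horner a digits)                        ≡⟨ cong (λ j → mulθℤ a j (horner a digits)) low≡ ⟩
      mulθℤ a (k ℤ.+ + n) (horner a digits)                ≡⟨ mulθℤ-+ k n (horner a digits) ⟩
      mulθℤ a k (mulθ^ a n (horner a digits))              ≡⟨ cong (mulθℤ a k) (horner-pad n digits) ⟨
      mulθℤ a k (horner a (replicate n 0 ++ digits))       ∎))
    where
    open ≡-Reasoning
    open GreedyExpansion e
    digits = lead ∷ rest

  expansion-≢-sum : 1 ≤ a → ∀ (e : GreedyExpansion a) {f g} →
    GreedyFrom (GreedyExpansion.low e ℤ.+ + 3) f → GreedyFrom (GreedyExpansion.low e ℤ.+ + 3) g →
    GreedyExpansion.value e ≢ f ⊕ g
  expansion-≢-sum 1≤a e (greedyFrom τ us gu refl) (greedyFrom τ′ vs gv refl) value≡ =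
    greedy-≢-signed-sum 1≤a greedy (ℕP.n≢0⇒n>0 lead≢0) gu gv (sign ·ₛ τ) (sign ·ₛ τ′)
      (θ^ℤ-cancel low sign τ τ′ (trans value≡ (cong₂ _⊕_ (shift τ us) (shift τ′ vs))))
    where
    open GreedyExpansion e
    shift : ∀ σ ws → applySign a σ (mulθℤ a (low ℤ.+ + 3) (horner a ws))
                   ≡ applySign a σ (mulθℤ a low (θ³* horner a ws))
    shift σ ws = cong (applySign a σ) (mulθℤ-+ low 3 (horner a ws))

  infix 4 _≤ᵛ_
  _≤ᵛ_ : InfraVal a → InfraVal a → Set
  _≤ᵛ_ = _≤v_ a

  ≤ᵛ-trans : ∀ {u v w} → u ≤ᵛ v → v ≤ᵛ w → u ≤ᵛ w
  ≤ᵛ-trans 0≤       _        = 0≤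
  ≤ᵛ-trans (θ≤ i≤j) (θ≤ j≤k) = θ≤ (ℤP.≤-trans i≤j j≤k)

  θ²*-mono-≤ᵛ : ∀ {u v} → u ≤ᵛ v → θ²*_ a u ≤ᵛ θ²*_ a v
  θ²*-mono-≤ᵛ 0≤       = 0≤
  θ²*-mono-≤ᵛ (θ≤ i≤j) = θ≤ (ℤP.+-monoˡ-≤ (+ 2) i≤j)

  ≤ᵛ-maxˡ : ∀ u v → u ≤ᵛ maxv a u v
  ≤ᵛ-maxˡ 0v      v       = 0≤
  ≤ᵛ-maxˡ (θ^ i) 0v      = θ≤ ℤP.≤-refl
  ≤ᵛ-maxˡ (θ^ i) (θ^ j) = θ≤ (ℤP.i≤i⊔j i j)

  ≤ᵛ-maxʳ : ∀ u v → v ≤ᵛ maxv a u v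
  ≤ᵛ-maxʳ 0v      0v      = 0≤
  ≤ᵛ-maxʳ 0v      (θ^ j) = θ≤ ℤP.≤-refl
  ≤ᵛ-maxʳ (θ^ i) 0v      = 0≤
  ≤ᵛ-maxʳ (θ^ i) (θ^ j) = θ≤ (ℤP.i≤j⊔i i j)

  bound-or-GreedyFrom : ∀ {f v} → HasInfranorm a f v → ∀ m →
    θ^ (ℤ.- m) ≤ᵛ θ²*_ a v ⊎ GreedyFrom (m ℤ.+ + 3) f
  bound-or-GreedyFrom (inj₁ (refl , refl)) m = inj₂ (GreedyFrom-𝟘 (m ℤ.+ + 3))
  bound-or-GreedyFrom (inj₂ (e , refl , refl)) m with exponent-gap m (GreedyExpansion.low e)
  ... | inj₁ −m≤−low+2 = inj₁ (θ≤ −m≤−low+2)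
  ... | inj₂ (n , low≡) = inj₂ (expansion-GreedyFrom e (m ℤ.+ + 3) n low≡)

  pmθ-⊕ : ∀ s f g → pmθ a s f g ≡ f ⊕ applySign a s g
  pmθ-⊕ plus  f g = refl
  pmθ-⊕ minus f g = refl

theorem4 : (a : ℕ) → 1 ≤ a →
    (s : Sign a) (f g : Zθ) (vf vg vh : InfraVal a) →
    HasInfranorm a f vf → HasInfranorm a g vg →
    HasInfranorm a (pmθ a s f g) vh →
    _≤v_ a vh (θ²*_ a (maxv a vf vg))
theorem4 a _   s f g vf vg vh hf hg (inj₁ (_ , refl)) = 0≤
theorem4 a 1≤a s f g vf vg vh hf hg (inj₂ (e , e≡f±g , refl))
  with bound-or-GreedyFrom a hf (GreedyExpansion.low e) | bound-or-GreedyFrom a hg (GreedyExpansion.low e)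
... | inj₁ vh≤θ²vf | _            = ≤ᵛ-trans a vh≤θ²vf (θ²*-mono-≤ᵛ a (≤ᵛ-maxˡ a vf vg))
... | inj₂ _       | inj₁ vh≤θ²vg = ≤ᵛ-trans a vh≤θ²vg (θ²*-mono-≤ᵛ a (≤ᵛ-maxʳ a vf vg))
... | inj₂ f-from  | inj₂ g-from  = ⊥-elim (expansion-≢-sum a 1≤a e f-from
                                      (GreedyFrom-applySign a s g-from) (trans e≡f±g (pmθ-⊕ a s f g)))
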